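{- For any graph $G$ without isolated vertices, $sp(G)\le |V(G)|-2\nu(G)+1$, where $\nu(G)$ is the size of a largest matching of $G$.
   Context: Graphs are finite, undirected, without loops, possibly with multiple edges. For a graph $G$ without isolated vertices, $sp(G)$ is the least integer $k$ such that $G$ has a subgraph $H$ with $V(H)=V(G)$ and $1\le d_H(x)\le k$ for all vertices $x$. -}

module Defs where

open import Data.Nat using (ℕ; zero; suc; _+_; _*_; _∸_; _≤_)
open import Data.Fin using (Fin)
open import Data.Bool using (Bool; true; false; if_then_else_)
open import Data.Product using (_×_; _,_; proj₁; proj₂; ∃)
open import Data.Sum using (_⊎_)
open import Relation.Binary.PropositionalEquality using (_≡_; _≢_)
open import Relation.Nullary using (¬_; Dec; yes; no)
open import Data.Fin using (_≟_)

-- A finite multigraph without loops: n vertices (Fin n), m edges (Fin m),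
-- each edge has two distinct endpoints.  Parallel edges are allowed.
record Graph : Set where
  field
    n     : ℕ
    m     : ℕ
    ends  : Fin m → Fin n × Fin n
    loopless : ∀ e → proj₁ (ends e) ≢ proj₂ (ends e)
open Graph public

Incident : (G : Graph) → Fin (m G) → Fin (n G) → Set
Incident G e x = (proj₁ (ends G e) ≡ x) ⊎ (proj₂ (ends G e) ≡ x)

incident? : (G : Graph) → (e : Fin (m G)) → (x : Fin (n G)) → Bool
incident? G e x with proj₁ (ends G e) ≟ x | proj₂ (ends G e) ≟ x
... | yes _ | _ = true
... | no _ | yes _ = true
... | no _ | no _ = false

count : ∀ {k} → (Fin k → Bool) → ℕ
count {zero} p = 0
count {suc k} p = (if p Fin.zero then 1 else 0) + count (λ i → p (Fin.suc i))

-- A (spanning) subgraph H of G with V(H) = V(G) is given by a set of edges.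
EdgeSet : Graph → Set
EdgeSet G = Fin (m G) → Bool

-- d_H(x): number of edges of H incident with x (no loops, so each counts once)
degree : (G : Graph) → EdgeSet G → Fin (n G) → ℕ
degree G H x = count (λ e → if H e then incident? G e x else false)

size : (G : Graph) → EdgeSet G → ℕ
size G H = count H

NoIsolatedVertices : Graph → Set
NoIsolatedVertices G = ∀ x → ∃ λ e → Incident G e x

IsMatching : (G : Graph) → EdgeSet G → Set
IsMatching G M = ∀ e f x → M e ≡ true → M f ≡ true → e ≢ f →
                 Incident G e x → ¬ Incident G f x

IsMatchingNumber : Graph → ℕ → Set
IsMatchingNumber G k =
  (∃ λ M → IsMatching G M × size G M ≡ k) ×
  (∀ M → IsMatching G M → size G M ≤ k)

-- sp(G) ≤ k : since sp(G) is the least k admitting a spanning subgraph H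
-- with 1 ≤ d_H(x) ≤ k for all x, sp(G) ≤ k iff such an H exists.
SpAtMost : Graph → ℕ → Set
SpAtMost G k = ∃ λ (H : EdgeSet G) → ∀ x → 1 ≤ degree G H x × degree G H x ≤ k

module Submission where

-- Fix a matching M of size ν.  Every vertex meets at most one edge
-- of M, so by the handshake lemma exactly 2ν vertices are covered by M and
-- the set U of unmatched vertices has at most n - 2ν elements.  Since G has
-- no isolated vertices we may choose, for each x ∈ U, an edge c(x) at x.
-- The spanning subgraph H = M ∪ c(U) covers every vertex, and a vertex x
-- meets at most one edge of M and at most |c(U)| ≤ |U| ≤ n - 2ν added
-- edges, so 1 ≤ d_H(x) ≤ n - 2ν + 1.

open import Defs
open import Data.Nat using (ℕ; zero; suc; _+_; _∸_; _*_; _≤_; z≤n; s≤s; _≡ᵇ_)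
open import Data.Nat.Properties
  using (+-*-semiring; +-mono-≤; ≤-refl; ≤-reflexive; ≤-trans; ≤-antisym;
         m≤n+m; +-monoʳ-≤; *-comm; *-identityʳ; m+n≤o⇒m≤o∸n; +-comm; +-identityʳ; module ≤-Reasoning)
open import Data.Fin as Fin using (Fin; _≟_)
open import Data.Fin.Properties using (suc-injective; 0≢1+n; any?)
open import Data.Bool using (Bool; true; false; if_then_else_; _∨_)
open import Data.Bool.Properties using (¬-not; ∨-zeroʳ) renaming (_≟_ to _≟ᵇ_)
open import Data.Product using (_×_; _,_; proj₁; proj₂; ∃)
open import Data.Sum using (inj₁; inj₂)
open import Function using (_∘_)
open import Relation.Nullary using (Dec; yes; no; contradiction)
open import Relation.Nullary.Decidable using (isYes; _×-dec_)
open import Relation.Binary.PropositionalEquality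
  using (_≡_; refl; sym; trans; cong; cong₂; subst; module ≡-Reasoning)
open import Algebra.Properties.Semiring.Sum +-*-semiring
  using (sum; sum-syntax; sum-cong-≗; ∑-comm; ∑-distrib-+; *-distribˡ-sum)

isYes-intro : ∀ {a} {A : Set a} (a? : Dec A) → A → isYes a? ≡ true
isYes-intro (yes _) _ = refl
isYes-intro (no ¬a) a = contradiction a ¬a

isYes-elim : ∀ {a} {A : Set a} (a? : Dec A) → isYes a? ≡ true → A
isYes-elim (yes a) _ = a

guard-elim : ∀ b c → (if b then c else false) ≡ true → (b ≡ true) × (c ≡ true)
guard-elim true c c≡true = refl , c≡true

⟦_⟧ : Bool → ℕ
⟦ b ⟧ = if b then 1 else 0

count-as-sum : ∀ {k} (p : Fin k → Bool) → count p ≡ ∑[ i < k ] ⟦ p i ⟧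
count-as-sum {zero} p = refl
count-as-sum {suc k} p = cong (⟦ p Fin.zero ⟧ +_) (count-as-sum (p ∘ Fin.suc))

sum-mono : ∀ {k} {f g : Fin k → ℕ} → (∀ i → f i ≤ g i) → sum f ≤ sum g
sum-mono {zero} f≤g = z≤n
sum-mono {suc k} f≤g = +-mono-≤ (f≤g Fin.zero) (sum-mono (f≤g ∘ Fin.suc))

sum-bounded : ∀ {k} (c : ℕ) (f : Fin k → ℕ) → (∀ i → f i ≤ c) → sum f ≤ k * c
sum-bounded {zero} c f f≤c = z≤n
sum-bounded {suc k} c f f≤c =
  +-mono-≤ (f≤c Fin.zero) (sum-bounded c (f ∘ Fin.suc) (f≤c ∘ Fin.suc))

⟦⟧-mono : ∀ {b c} → (b ≡ true → c ≡ true) → ⟦ b ⟧ ≤ ⟦ c ⟧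
⟦⟧-mono {false} b⇒c = z≤n
⟦⟧-mono {true} b⇒c rewrite b⇒c refl = ≤-refl

count-mono : ∀ {k} {p q : Fin k → Bool} →
  (∀ i → p i ≡ true → q i ≡ true) → count p ≤ count q
count-mono {zero} p⇒q = z≤n
count-mono {suc k} p⇒q = +-mono-≤ (⟦⟧-mono (p⇒q Fin.zero)) (count-mono (p⇒q ∘ Fin.suc))

⟦∨⟧≤ : ∀ b c → ⟦ b ∨ c ⟧ ≤ ⟦ b ⟧ + ⟦ c ⟧
⟦∨⟧≤ true c = s≤s z≤n
⟦∨⟧≤ false c = ≤-refl

count-∨ : ∀ {k} (p q : Fin k → Bool) → count (λ i → p i ∨ q i) ≤ count p + count q
count-∨ {k} p q = begin
  count (λ i → p i ∨ q i)              ≡⟨ count-as-sum (λ i → p i ∨ q i) ⟩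
  ∑[ i < k ] ⟦ p i ∨ q i ⟧             ≤⟨ sum-mono (λ i → ⟦∨⟧≤ (p i) (q i)) ⟩
  ∑[ i < k ] (⟦ p i ⟧ + ⟦ q i ⟧)       ≡⟨ ∑-distrib-+ (λ i → ⟦ p i ⟧) (λ i → ⟦ q i ⟧) ⟩
  ∑[ i < k ] ⟦ p i ⟧ + ∑[ i < k ] ⟦ q i ⟧ ≡⟨ sym (cong₂ _+_ (count-as-sum p) (count-as-sum q)) ⟩
  count p + count q                    ∎
  where open ≤-Reasoning

count-≥1 : ∀ {k} {p : Fin k → Bool} (i : Fin k) → p i ≡ true → 1 ≤ count p
count-≥1 {p = p} Fin.zero pi rewrite pi = s≤s z≤n
count-≥1 {p = p} (Fin.suc i) pi =
  ≤-trans (count-≥1 {p = p ∘ Fin.suc} i pi) (m≤n+m _ ⟦ p Fin.zero ⟧)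

count-witness : ∀ {k} (p : Fin k → Bool) → 1 ≤ count p → ∃ λ i → p i ≡ true
count-witness {suc k} p pos with p Fin.zero in p0
... | true = Fin.zero , p0
... | false with count-witness (p ∘ Fin.suc) pos
...   | i , pi = Fin.suc i , pi

count-none : ∀ {k} (p : Fin k → Bool) → (∀ i → p i ≡ false) → count p ≡ 0
count-none {zero} p none = refl
count-none {suc k} p none rewrite none Fin.zero = count-none (p ∘ Fin.suc) (none ∘ Fin.suc)

count-≤1 : ∀ {k} (p : Fin k → Bool) →
  (∀ i j → p i ≡ true → p j ≡ true → i ≡ j) → count p ≤ 1
count-≤1 {zero} p unique = z≤n
count-≤1 {suc k} p unique with p Fin.zero in p0
... | true = ≤-reflexive (cong suc (count-none (p ∘ Fin.suc) rest-false))
  where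
  rest-false : ∀ i → p (Fin.suc i) ≡ false
  rest-false i = ¬-not (λ pi → 0≢1+n (unique Fin.zero (Fin.suc i) p0 pi))
... | false = count-≤1 (p ∘ Fin.suc) (λ i j pi pj → suc-injective (unique _ _ pi pj))

singleton : ∀ {k} → Fin k → Fin k → Bool
singleton i j = isYes (i ≟ j)

count-singleton : ∀ {k} (i : Fin k) → count (singleton i) ≡ 1
count-singleton i = ≤-antisym
  (count-≤1 (singleton i) (λ j j′ ij ij′ →
     trans (sym (isYes-elim (i ≟ j) ij)) (isYes-elim (i ≟ j′) ij′)))
  (count-≥1 i (isYes-intro (i ≟ i) refl))

count-guard : ∀ {k} (b : Bool) (p : Fin k → Bool) →
  count (λ i → if b then p i else false) ≡ ⟦ b ⟧ * count p
count-guard true p = sym (+-identityʳ (count p))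
count-guard {k} false p = count-none {k} (λ _ → false) (λ _ → refl)

image : ∀ {a b} → (Fin a → Bool) → (Fin a → Fin b) → Fin b → Bool
image P f y = isYes (any? (λ x → (P x ≟ᵇ true) ×-dec (f x ≟ y)))

image-intro : ∀ {a b} (P : Fin a → Bool) (f : Fin a → Fin b) x →
  P x ≡ true → image P f (f x) ≡ true
image-intro P f x Px = isYes-intro (any? _) (x , Px , refl)

-- |f(P)| ≤ |P|, by double counting the pairs (x, y) with P x and f x = y.
count-image : ∀ {a b} (P : Fin a → Bool) (f : Fin a → Fin b) →
  count (image P f) ≤ count P
count-image {a} {b} P f = begin
  count (image P f)                   ≡⟨ count-as-sum (image P f) ⟩
  ∑[ y < b ] ⟦ image P f y ⟧          ≤⟨ sum-mono image-covered ⟩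
  ∑[ y < b ] count (λ x → hit x y)    ≡⟨ sum-cong-≗ (λ y → count-as-sum (λ x → hit x y)) ⟩
  ∑[ y < b ] ∑[ x < a ] ⟦ hit x y ⟧   ≡⟨ ∑-comm (λ y x → ⟦ hit x y ⟧) ⟩
  ∑[ x < a ] ∑[ y < b ] ⟦ hit x y ⟧   ≡⟨ sum-cong-≗ hits-of ⟩
  ∑[ x < a ] ⟦ P x ⟧                  ≡⟨ sym (count-as-sum P) ⟩
  count P                             ∎
  where
  open ≤-Reasoning
  hit : Fin a → Fin b → Bool
  hit x y = if P x then singleton (f x) y else false

  hit-self : ∀ x → P x ≡ true → hit x (f x) ≡ true
  hit-self x Px rewrite Px = isYes-intro (f x ≟ f x) refl

  image-covered : ∀ y → ⟦ image P f y ⟧ ≤ count (λ x → hit x y)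
  image-covered y with image P f y in imy
  ... | false = z≤n
  ... | true with isYes-elim (any? _) imy
  ...   | x , Px , refl = count-≥1 x (hit-self x Px)

  hits-of : ∀ x → ∑[ y < b ] ⟦ hit x y ⟧ ≡ ⟦ P x ⟧
  hits-of x = begin-equality
    ∑[ y < b ] ⟦ hit x y ⟧         ≡⟨ sym (count-as-sum (hit x)) ⟩
    count (hit x)                  ≡⟨ count-guard (P x) (singleton (f x)) ⟩
    ⟦ P x ⟧ * count (singleton (f x)) ≡⟨ cong (⟦ P x ⟧ *_) (count-singleton (f x)) ⟩
    ⟦ P x ⟧ * 1                    ≡⟨ *-identityʳ ⟦ P x ⟧ ⟩
    ⟦ P x ⟧                        ∎

module _ (G : Graph) where

  incidentIn : EdgeSet G → Fin (n G) → Fin (m G) → Bool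
  incidentIn H x e = if H e then incident? G e x else false

  incident?-sound : ∀ e x → incident? G e x ≡ true → Incident G e x
  incident?-sound e x is-incident with proj₁ (ends G e) ≟ x | proj₂ (ends G e) ≟ x
  ... | yes u≡x | _ = inj₁ u≡x
  ... | no _ | yes v≡x = inj₂ v≡x

  incident?-complete : ∀ e x → Incident G e x → incident? G e x ≡ true
  incident?-complete e x e∋x with proj₁ (ends G e) ≟ x | proj₂ (ends G e) ≟ x
  ... | yes _ | _ = refl
  ... | no _ | yes _ = refl
  incident?-complete e x (inj₁ u≡x) | no u≢x | no _ = contradiction u≡x u≢x
  incident?-complete e x (inj₂ v≡x) | no _ | no v≢x = contradiction v≡x v≢x

  -- As G has no loops, x is incident with e = uv iff x = u or x = v, and
  -- never both; hence every edge has exactly two endpoints.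
  incident?-split : ∀ e x → ⟦ incident? G e x ⟧ ≡
    ⟦ singleton (proj₁ (ends G e)) x ⟧ + ⟦ singleton (proj₂ (ends G e)) x ⟧
  incident?-split e x with proj₁ (ends G e) ≟ x | proj₂ (ends G e) ≟ x
  ... | yes u≡x | yes v≡x = contradiction (trans u≡x (sym v≡x)) (loopless G e)
  ... | yes _ | no _ = refl
  ... | no _ | yes _ = refl
  ... | no _ | no _ = refl

  endpoints : ∀ e → count (incident? G e) ≡ 2
  endpoints e = begin
    count (incident? G e)                          ≡⟨ count-as-sum (incident? G e) ⟩
    ∑[ x < n G ] ⟦ incident? G e x ⟧               ≡⟨ sum-cong-≗ (incident?-split e) ⟩
    ∑[ x < n G ] (⟦ singleton u x ⟧ + ⟦ singleton v x ⟧)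
      ≡⟨ ∑-distrib-+ (λ x → ⟦ singleton u x ⟧) (λ x → ⟦ singleton v x ⟧) ⟩
    ∑[ x < n G ] ⟦ singleton u x ⟧ + ∑[ x < n G ] ⟦ singleton v x ⟧
      ≡⟨ sym (cong₂ _+_ (count-as-sum (singleton u)) (count-as-sum (singleton v))) ⟩
    count (singleton u) + count (singleton v)      ≡⟨ cong₂ _+_ (count-singleton u) (count-singleton v) ⟩
    2                                              ∎
    where
    open ≡-Reasoning
    u v : Fin (n G)
    u = proj₁ (ends G e)
    v = proj₂ (ends G e)

  edge-contribution : ∀ H e → count (λ x → incidentIn H x e) ≡ 2 * ⟦ H e ⟧
  edge-contribution H e = begin
    count (λ x → incidentIn H x e)     ≡⟨ count-guard (H e) (incident? G e) ⟩
    ⟦ H e ⟧ * count (incident? G e)    ≡⟨ cong (⟦ H e ⟧ *_) (endpoints e) ⟩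
    ⟦ H e ⟧ * 2                        ≡⟨ *-comm ⟦ H e ⟧ 2 ⟩
    2 * ⟦ H e ⟧                        ∎
    where open ≡-Reasoning

  handshake : ∀ H → ∑[ x < n G ] degree G H x ≡ 2 * size G H
  handshake H = begin
    ∑[ x < n G ] degree G H x                               ≡⟨ sum-cong-≗ (λ x → count-as-sum (incidentIn H x)) ⟩
    ∑[ x < n G ] ∑[ e < m G ] ⟦ incidentIn H x e ⟧          ≡⟨ ∑-comm (λ x e → ⟦ incidentIn H x e ⟧) ⟩
    ∑[ e < m G ] ∑[ x < n G ] ⟦ incidentIn H x e ⟧          ≡⟨ sum-cong-≗ per-edge ⟩
    ∑[ e < m G ] (2 * ⟦ H e ⟧)                             ≡⟨ sym (*-distribˡ-sum 2 (λ e → ⟦ H e ⟧)) ⟩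
    2 * (∑[ e < m G ] ⟦ H e ⟧)                             ≡⟨ cong (2 *_) (sym (count-as-sum H)) ⟩
    2 * size G H                                           ∎
    where
    open ≡-Reasoning
    per-edge : ∀ e → ∑[ x < n G ] ⟦ incidentIn H x e ⟧ ≡ 2 * ⟦ H e ⟧
    per-edge e = trans (sym (count-as-sum (λ x → incidentIn H x e))) (edge-contribution H e)

  matching-degree≤1 : ∀ {M} → IsMatching G M → ∀ x → degree G M x ≤ 1
  matching-degree≤1 {M} isM x = count-≤1 (incidentIn M x) unique
    where
    unique : ∀ e f → incidentIn M x e ≡ true → incidentIn M x f ≡ true → e ≡ f
    unique e f e∈ f∈ with e ≟ f | guard-elim (M e) _ e∈ | guard-elim (M f) _ f∈
    ... | yes e≡f | _ | _ = e≡f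
    ... | no e≢f | Me , e∋x | Mf , f∋x =
      contradiction (incident?-sound f x f∋x)
        (isM e f x Me Mf e≢f (incident?-sound e x e∋x))

  degree-≥1 : ∀ {H e x} → H e ≡ true → Incident G e x → 1 ≤ degree G H x
  degree-≥1 {H} {e} {x} He e∋x = count-≥1 {p = incidentIn H x} e in-H
    where
    in-H : incidentIn H x e ≡ true
    in-H rewrite He = incident?-complete e x e∋x

  degree-witness : ∀ H x → 1 ≤ degree G H x → ∃ λ e → (H e ≡ true) × Incident G e x
  degree-witness H x pos with count-witness (incidentIn H x) pos
  ... | e , e∈ with guard-elim (H e) _ e∈
  ...   | He , e∋x = e , He , incident?-sound e x e∋x

  _∪_ : EdgeSet G → EdgeSet G → EdgeSet G
  (H ∪ A) e = H e ∨ A e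

  ∪-incidence : ∀ H A x e → incidentIn (H ∪ A) x e ≡ true → (incidentIn H x e ∨ A e) ≡ true
  ∪-incidence H A x e with H e | A e
  ... | true | a = cong (_∨ a)
  ... | false | true = λ _ → refl
  ... | false | false = λ ()

  degree-∪ : ∀ H A x → degree G (H ∪ A) x ≤ degree G H x + size G A
  degree-∪ H A x = ≤-trans (count-mono (∪-incidence H A x)) (count-∨ (incidentIn H x) A)

  unmatched : EdgeSet G → Fin (n G) → Bool
  unmatched M x = degree G M x ≡ᵇ 0

  -- Each vertex is either unmatched or meets exactly one edge of M.
  unmatched-or-covered : ∀ d → d ≤ 1 → ⟦ d ≡ᵇ 0 ⟧ + d ≤ 1
  unmatched-or-covered zero _ = s≤s z≤n
  unmatched-or-covered (suc d) d<1 = d<1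

  few-unmatched : ∀ {M} → IsMatching G M → count (unmatched M) ≤ n G ∸ 2 * size G M
  few-unmatched {M} isM = m+n≤o⇒m≤o∸n (count (unmatched M)) (begin
    count (unmatched M) + 2 * size G M
      ≡⟨ cong₂ _+_ (count-as-sum (unmatched M)) (sym (handshake M)) ⟩
    ∑[ x < n G ] ⟦ unmatched M x ⟧ + ∑[ x < n G ] degree G M x
      ≡⟨ sym (∑-distrib-+ (λ x → ⟦ unmatched M x ⟧) (degree G M)) ⟩
    ∑[ x < n G ] (⟦ unmatched M x ⟧ + degree G M x)
      ≤⟨ sum-bounded 1 _ (λ x → unmatched-or-covered _ (matching-degree≤1 isM x)) ⟩
    n G * 1
      ≡⟨ *-identityʳ (n G) ⟩
    n G ∎)
    where open ≤-Reasoning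

  module Cover (noIso : NoIsolatedVertices G) (M : EdgeSet G) (isM : IsMatching G M) where

    edgeAt : Fin (n G) → Fin (m G)
    edgeAt x = proj₁ (noIso x)

    added : EdgeSet G
    added = image (unmatched M) edgeAt

    cover : EdgeSet G
    cover = M ∪ added

    -- A matched vertex keeps its M-edge; an unmatched one gets edgeAt x.
    cover-covers : ∀ x → 1 ≤ degree G cover x
    cover-covers x with degree G M x in dM
    ... | suc _ with degree-witness M x (subst (1 ≤_) (sym dM) (s≤s z≤n))
    ...   | e , Me , e∋x = degree-≥1 {cover} (cong (_∨ added e) Me) e∋x
    cover-covers x | zero =
      degree-≥1 {cover} (trans (cong (M (edgeAt x) ∨_) edgeAt-added) (∨-zeroʳ _)) (proj₂ (noIso x))
      where
      edgeAt-added : added (edgeAt x) ≡ true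
      edgeAt-added = image-intro (unmatched M) edgeAt x (cong (_≡ᵇ 0) dM)

    cover-degree≤ : ∀ x → degree G cover x ≤ 1 + count (unmatched M)
    cover-degree≤ x = ≤-trans (degree-∪ M added x)
      (+-mono-≤ (matching-degree≤1 isM x) (count-image (unmatched M) edgeAt))

  sp-bound-from-matching : NoIsolatedVertices G → ∀ M → IsMatching G M →
    SpAtMost G ((n G ∸ 2 * size G M) + 1)
  sp-bound-from-matching noIso M isM = cover , λ x → cover-covers x , bounded x
    where
    open Cover noIso M isM
    bounded : ∀ x → degree G cover x ≤ (n G ∸ 2 * size G M) + 1
    bounded x = begin
      degree G cover x                ≤⟨ cover-degree≤ x ⟩
      1 + count (unmatched M)         ≤⟨ +-monoʳ-≤ 1 (few-unmatched isM) ⟩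
      1 + (n G ∸ 2 * size G M)        ≡⟨ +-comm 1 _ ⟩
      (n G ∸ 2 * size G M) + 1        ∎
      where open ≤-Reasoning

mainTheorem15 : (G : Graph) → NoIsolatedVertices G → (ν : ℕ) → IsMatchingNumber G ν →
    SpAtMost G ((n G ∸ 2 * ν) + 1)
mainTheorem15 G noIso ν ((M , isM , |M|≡ν) , _) =
  subst (λ k → SpAtMost G ((n G ∸ 2 * k) + 1)) |M|≡ν (sp-bound-from-matching G noIso M isM)
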